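{- Let $n\geq 2$. The convex cone of positive convex vectors in $\mathbb{R}^n$ has exactly $2n-2$ extreme rays, namely the rays spanned by the $n-1$ standard increasing convex vectors $\mathbf{a}^{(1)},\ldots,\mathbf{a}^{(n-1)}$ and the $n-1$ standard decreasing convex vectors $\mathbf{b}^{(1)},\ldots,\mathbf{b}^{(n-1)}$.
   Context: A vector $\mathbf{a}=(a_1,\ldots,a_n)\in\mathbb{R}^n$ is positive if $a_i\geq 0$ for all $i$, increasing if $a_{i+1}\ge a_i$ for all $1\le i<n$, decreasing if $a_{i+1}\le a_i$ for all $1\le i<n$, and convex if $a_{i+1}-2a_i+a_{i-1}\geq 0$ for all $1<i<n$. The positive convex vectors form a closed convex cone. For $1\le i<n$, $\mathbf{a}^{(i)}$ is the componentwise-maximal positive increasing convex vector with maximal component $1$ and exactly $i$ zero components, explicitly $a^{(i)}_j=\max\!\left(0,\frac{j-i}{n-i}\right)$; and $\mathbf{b}^{(i)}$ is the componentwise-maximal positive decreasing convex vector with maximal component $1$ and exactly $i$ zero components, explicitly $b^{(i)}_j=\max\!\left(0,\frac{n-i+1-j}{n-i}\right)$.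
   Formalization: The cone of positive convex vectors, together with the decompositions and scalar multiples used to define extreme rays, is taken in ℚ^n rather than ℝ^n. -}

module Defs where

open import Data.Nat using (ℕ; suc; _∸_)
open import Data.Fin using (Fin; zero; suc; toℕ; inject₁)
open import Data.Integer as ℤ using (ℤ; +_)
open import Data.Rational using (ℚ; 0ℚ; _≤_; _<_; _+_; _-_; _*_; _⊔_; _/_)
open import Data.Sum using (_⊎_; inj₁; inj₂)
open import Data.Product using (_×_; ∃)
open import Relation.Binary.PropositionalEquality using (_≡_; _≢_)

-- Vectors in ℚ^n, as functions Fin n → ℚ (component j is the (toℕ j + 1)-th).
Vecℚ : ℕ → Set
Vecℚ n = Fin n → ℚ

Positive : ∀ {n} → Vecℚ n → Set
Positive v = ∀ j → 0ℚ ≤ v j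

-- Convexity for vectors of length n = m + 2:
-- a_{i+1} - 2 a_i + a_{i-1} ≥ 0 for all 1 < i < n.
-- Index i : Fin m stands for the triple of 0-based positions i, i+1, i+2.
Convex : ∀ m → Vecℚ (suc (suc m)) → Set
Convex m v = ∀ (i : Fin m) →
  0ℚ ≤ (v (inject₁ (inject₁ i)) + v (suc (suc i))) - (v (suc (inject₁ i)) + v (suc (inject₁ i)))

InCone : ∀ m → Vecℚ (suc (suc m)) → Set
InCone m v = Positive v × Convex m v

NonZero : ∀ {n} → Vecℚ n → Set
NonZero v = ∃ λ j → v j ≢ 0ℚ

_≡_·_ : ∀ {n} → Vecℚ n → ℚ → Vecℚ n → Set
u ≡ c · v = ∀ j → u j ≡ c * v j

SameRay : ∀ {n} → Vecℚ n → Vecℚ n → Set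
SameRay u v = ∃ λ c → (0ℚ < c) × (u ≡ c · v)

SpansExtremeRay : ∀ m → Vecℚ (suc (suc m)) → Set
SpansExtremeRay m v =
  InCone m v × NonZero v ×
  (∀ (x y : Vecℚ (suc (suc m))) → InCone m x → InCone m y →
     (∀ j → v j ≡ x j + y j) →
     (∃ λ c → (0ℚ ≤ c) × (x ≡ c · v)) × (∃ λ d → (0ℚ ≤ d) × (y ≡ d · v)))

-- n = m + 2. For i ∈ {1,…,n-1} (encoded as i₀ : Fin (m+1), i = i₀ + 1) and
-- j ∈ {1,…,n} (encoded as j₀ : Fin n, j = j₀ + 1):
-- a^(i)_j = max(0, (j - i)/(n - i)),   n - i = m + 1 - i₀
vecA : ∀ m → Fin (suc m) → Vecℚ (suc (suc m))
vecA m i j = 0ℚ ⊔ ((+ toℕ j ℤ.- + toℕ i) / suc (m ∸ toℕ i))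

-- b^(i)_j = max(0, (n - i + 1 - j)/(n - i)),   n - i + 1 - j = m + 1 - i₀ - j₀
vecB : ∀ m → Fin (suc m) → Vecℚ (suc (suc m))
vecB m i j = 0ℚ ⊔ (((+ suc m) ℤ.- + toℕ i ℤ.- + toℕ j) / suc (m ∸ toℕ i))

gen : ∀ m → Fin (suc m) ⊎ Fin (suc m) → Vecℚ (suc (suc m))
gen m (inj₁ i) = vecA m i
gen m (inj₂ i) = vecB m i

-- Read a vector as a sequence f on the indices 0, …, n − 1; it lies in the cone iff it is
-- nonnegative and its slopes Δf are nondecreasing. The ramp a⁽ⁱ⁾ vanishes up to its i-th
-- coordinate and is affine after it. In a decomposition a⁽ⁱ⁾ = x + y inside the cone both the
-- zeros and the vanishing second differences pass to x and y, because all of these quantities are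
-- nonnegative; so x is zero up to i and affine after it, hence a multiple of a⁽ⁱ⁾. The b⁽ⁱ⁾ are the
-- reversals of the a⁽ⁱ⁾. Conversely let f be extreme. If its last slope is positive, let i be the
-- last kink of f: subtracting a small multiple of a⁽ⁱ⁾ stays in the cone, and extremality puts f
-- on the ray of a⁽ⁱ⁾. If its first slope is negative, the same applies to the reversal of f and
-- yields some b⁽ⁱ⁾. Otherwise all slopes vanish and f is a positive constant c, which is not
-- extreme because c = c·a⁽¹⁾ + c·b⁽¹⁾. The generators span distinct rays since their zero sets
-- differ.

{-# OPTIONS --safe #-}
module Submission where

open import Defs
open import Data.Nat as ℕ using (ℕ; zero; suc; _∸_; z≤n; s≤s; _≤′_; ≤′-refl; ≤′-step)
import Data.Nat.Properties as ℕ
open import Data.Fin as Fin using (Fin; toℕ; inject₁; opposite)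
import Data.Fin.Properties as Fin
open import Data.Integer as ℤ using (+_; -[1+_])
import Data.Integer.Properties as ℤ
import Data.Integer.Solver as ℤ-Solver
open import Data.Rational
  using (ℚ; 0ℚ; 1ℚ; _≤_; _<_; _+_; _-_; -_; _*_; _⊔_; _⊓_; _/_; 1/_; positive; nonNegative; toℚᵘ)
open import Data.Rational.Properties
import Data.Rational.Unnormalised as ℚᵘ
import Data.Rational.Unnormalised.Properties as ℚᵘ
import Data.Rational.Solver as ℚ-Solver
open import Data.Product using (_×_; _,_; ∃; proj₁; proj₂)
open import Data.Sum using (_⊎_; inj₁; inj₂; [_,_]′)
open import Data.Empty using (⊥; ⊥-elim)
open import Data.Vec.Functional using (reverse)
open import Function using (_∘_)
open import Relation.Binary using (tri<; tri≈; tri>)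
open import Relation.Binary.PropositionalEquality
open import Relation.Nullary using (Dec; yes; no)
open import Relation.Nullary.Decidable using (toSum)

≤∧≢⇒< : ∀ {p q} → p ≤ q → p ≢ q → p < q
≤∧≢⇒< {p} {q} p≤q p≢q with <-cmp p q
... | tri< p<q _ _ = p<q
... | tri≈ _ p≡q _ = ⊥-elim (p≢q p≡q)
... | tri> _ _ p>q = ⊥-elim (<-irrefl refl (<-≤-trans p>q p≤q))

nonNeg+nonNeg≡0⇒≡0 : ∀ {p q} → 0ℚ ≤ p → 0ℚ ≤ q → p + q ≡ 0ℚ → p ≡ 0ℚ
nonNeg+nonNeg≡0⇒≡0 {p} {q} 0≤p 0≤q p+q≡0 = ≤-antisym p≤0 0≤p
  where
  p≤0 : p ≤ 0ℚ
  p≤0 = begin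
    p      ≡⟨ +-identityʳ p ⟨
    p + 0ℚ ≤⟨ +-monoʳ-≤ p 0≤q ⟩
    p + q  ≡⟨ p+q≡0 ⟩
    0ℚ     ∎
    where open ≤-Reasoning

p≤q⇒0≤q-p : ∀ {p q} → p ≤ q → 0ℚ ≤ q - p
p≤q⇒0≤q-p {p} p≤q = ≤-trans (≤-reflexive (sym (+-inverseʳ p))) (+-monoˡ-≤ (- p) p≤q)

p-q≡0⇒p≡q : ∀ {p q} → p - q ≡ 0ℚ → p ≡ q
p-q≡0⇒p≡q {p} {q} p-q≡0 = begin
  p            ≡⟨ solve 2 (λ p q → p := (p :- q) :+ q) refl p q ⟩
  (p - q) + q  ≡⟨ cong (_+ q) p-q≡0 ⟩
  0ℚ + q       ≡⟨ +-identityˡ q ⟩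
  q            ∎
  where
  open ≡-Reasoning
  open ℚ-Solver.+-*-Solver

p-q*0≡p : ∀ p q → p - q * 0ℚ ≡ p
p-q*0≡p p q = trans (cong (λ a → p - a) (*-zeroʳ q)) (+-identityʳ p)

p≤p+q : ∀ {p q} → 0ℚ ≤ q → p ≤ p + q
p≤p+q {p} 0≤q = ≤-trans (≤-reflexive (sym (+-identityʳ p))) (+-monoʳ-≤ p 0≤q)

0≤* : ∀ {p q} → 0ℚ ≤ p → 0ℚ ≤ q → 0ℚ ≤ p * q
0≤* {p} {q} 0≤p 0≤q = nonNegative⁻¹ (p * q) {{nonNeg*nonNeg⇒nonNeg p {{nonNegative 0≤p}} q {{nonNegative 0≤q}}}}

0<* : ∀ {p q} → 0ℚ < p → 0ℚ < q → 0ℚ < p * q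
0<* {p} {q} 0<p 0<q = positive⁻¹ (p * q) {{pos*pos⇒pos p {{positive 0<p}} q {{positive 0<q}}}}

module _ {p : ℚ} (0<p : 0ℚ < p) where
  private instance
    p≢0 = pos⇒nonZero p {{positive 0<p}}

  recip : ℚ
  recip = 1/ p

  recip-pos : 0ℚ < recip
  recip-pos = positive⁻¹ recip {{1/pos⇒pos p {{positive 0<p}}}}

  *-recip-cancelʳ : ∀ q → q * recip * p ≡ q
  *-recip-cancelʳ q = begin
    q * recip * p    ≡⟨ *-assoc q recip p ⟩
    q * (recip * p)  ≡⟨ cong (q *_) (*-inverseˡ p) ⟩
    q * 1ℚ           ≡⟨ *-identityʳ q ⟩
    q                ∎
    where open ≡-Reasoning

  recip-*-cancelˡ : ∀ q → recip * (p * q) ≡ q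
  recip-*-cancelˡ q = begin
    recip * (p * q)  ≡⟨ *-assoc recip p q ⟨
    recip * p * q    ≡⟨ cong (_* q) (*-inverseˡ p) ⟩
    1ℚ * q           ≡⟨ *-identityˡ q ⟩
    q                ∎
    where open ≡-Reasoning

nonPos/n≤0 : ∀ i n → i ℤ.≤ + 0 → i / suc n ≤ 0ℚ
nonPos/n≤0 (+ zero)   n _             = ≤-reflexive (0/n≡0 (suc n))
nonPos/n≤0 (+ suc k)  n (ℤ.+≤+ ())
nonPos/n≤0 -[1+ k ]   n _             = neg-antimono-≤ (nonNegative⁻¹ _ {{normalize-nonNeg (suc k) (suc n)}})

+a/n++b/n≡+[a+b]/n : ∀ a b n → + a / suc n + + b / suc n ≡ + (a ℕ.+ b) / suc n
+a/n++b/n≡+[a+b]/n a b n = toℚᵘ-injective (begin-equality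
  toℚᵘ (+ a / suc n + + b / suc n)             ≃⟨ toℚᵘ-homo-+ (+ a / suc n) (+ b / suc n) ⟩
  toℚᵘ (+ a / suc n) ℚᵘ.+ toℚᵘ (+ b / suc n)   ≃⟨ ℚᵘ.+-cong (toℚᵘ-fromℚᵘ a/n) (toℚᵘ-fromℚᵘ b/n) ⟩
  a/n ℚᵘ.+ b/n                                 ≃⟨ ℚᵘ.*≡* cross-multiplied ⟩
  ℚᵘ.mkℚᵘ (+ (a ℕ.+ b)) n                      ≃⟨ toℚᵘ-fromℚᵘ (ℚᵘ.mkℚᵘ (+ (a ℕ.+ b)) n) ⟨
  toℚᵘ (+ (a ℕ.+ b) / suc n)                   ∎)
  where
  open ℚᵘ.≤-Reasoning
  open ℤ-Solver.+-*-Solver using (solve; _:=_; _:+_; _:*_)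
  a/n = ℚᵘ.mkℚᵘ (+ a) n
  b/n = ℚᵘ.mkℚᵘ (+ b) n
  cross-multiplied : (+ a ℤ.* + suc n ℤ.+ + b ℤ.* + suc n) ℤ.* + suc n ≡ + (a ℕ.+ b) ℤ.* (+ suc n ℤ.* + suc n)
  cross-multiplied rewrite ℤ.pos-+ a b =
    solve 3 (λ a b d → (a :* d :+ b :* d) :* d := (a :+ b) :* (d :* d)) refl (+ a) (+ b) (+ suc n)

+n/n≡1 : ∀ n → + suc n / suc n ≡ 1ℚ
+n/n≡1 n = fromℚᵘ-cong {ℚᵘ.mkℚᵘ (+ suc n) n} {ℚᵘ.1ℚᵘ}
  (ℚᵘ.*≡* (trans (ℤ.*-identityʳ (+ suc n)) (sym (ℤ.*-identityˡ (+ suc n)))))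

+[m∸n]≡+m-+n : ∀ {m n} → n ℕ.≤ m → + (m ∸ n) ≡ + m ℤ.- + n
+[m∸n]≡+m-+n {m} {n} n≤m = trans (sym (ℤ.⊖-≥ n≤m)) (sym (ℤ.m-n≡m⊖n m n))

-- Finite differences

induction-between : ∀ {ℓ} (P : ℕ → Set ℓ) {a b} → P a →
  (∀ {k} → a ℕ.≤ k → k ℕ.< b → P k → P (suc k)) → ∀ {j} → a ℕ.≤ j → j ℕ.≤ b → P j
induction-between P {a} {b} Pa step a≤j = go (ℕ.≤⇒≤′ a≤j)
  where
  go : ∀ {j} → a ≤′ j → j ℕ.≤ b → P j
  go ≤′-refl          _     = Pa
  go (≤′-step a≤′j)   1+j≤b = step (ℕ.≤′⇒≤ a≤′j) 1+j≤b (go a≤′j (ℕ.<⇒≤ 1+j≤b))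

-- The shape of the expression in Convex, so that Δ² of a vector's sequence unfolds to it.
secondDiff : ℚ → ℚ → ℚ → ℚ
secondDiff a b c = (a + c) - (b + b)

secondDiff-cong : ∀ {a b c a′ b′ c′} → a ≡ a′ → b ≡ b′ → c ≡ c′ → secondDiff a b c ≡ secondDiff a′ b′ c′
secondDiff-cong refl refl refl = refl

secondDiff-comm : ∀ a b c → secondDiff a b c ≡ secondDiff c b a
secondDiff-comm a b c = cong (_- (b + b)) (+-comm a c)

secondDiff-+ : ∀ a b c a′ b′ c′ →
  secondDiff (a + a′) (b + b′) (c + c′) ≡ secondDiff a b c + secondDiff a′ b′ c′
secondDiff-+ = solve 6 (λ a b c a′ b′ c′ →
  ((a :+ a′) :+ (c :+ c′)) :- ((b :+ b′) :+ (b :+ b′)) := ((a :+ c) :- (b :+ b)) :+ ((a′ :+ c′) :- (b′ :+ b′))) refl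
  where open ℚ-Solver.+-*-Solver

secondDiff-* : ∀ t a b c → secondDiff (t * a) (t * b) (t * c) ≡ t * secondDiff a b c
secondDiff-* = solve 4 (λ t a b c → ((t :* a) :+ (t :* c)) :- ((t :* b) :+ (t :* b)) := t :* ((a :+ c) :- (b :+ b))) refl
  where open ℚ-Solver.+-*-Solver

secondDiff-sub-* : ∀ t a b c a′ b′ c′ →
  secondDiff (a - t * a′) (b - t * b′) (c - t * c′) ≡ secondDiff a b c - t * secondDiff a′ b′ c′
secondDiff-sub-* = solve 7 (λ t a b c a′ b′ c′ →
  ((a :- t :* a′) :+ (c :- t :* c′)) :- ((b :- t :* b′) :+ (b :- t :* b′)) := ((a :+ c) :- (b :+ b)) :- t :* ((a′ :+ c′) :- (b′ :+ b′))) refl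
  where open ℚ-Solver.+-*-Solver

Seq : Set
Seq = ℕ → ℚ

Δ : Seq → Seq
Δ f k = f (suc k) - f k

Δ² : Seq → Seq
Δ² f k = secondDiff (f k) (f (suc k)) (f (suc (suc k)))

step-Δ : ∀ f k → f (suc k) ≡ f k + Δ f k
step-Δ f k = solve 2 (λ a b → b := a :+ (b :- a)) refl (f k) (f (suc k))
  where open ℚ-Solver.+-*-Solver

Δ-suc : ∀ f k → Δ f (suc k) ≡ Δ f k + Δ² f k
Δ-suc f k = solve 3 (λ a b c → c :- b := (b :- a) :+ ((a :+ c) :- (b :+ b))) refl (f k) (f (suc k)) (f (suc (suc k)))
  where open ℚ-Solver.+-*-Solver

Δ-sub-* : ∀ f g t k → Δ (λ j → f j - t * g j) k ≡ Δ f k - t * Δ g k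
Δ-sub-* f g t k = solve 5 (λ t a b a′ b′ → (b :- t :* b′) :- (a :- t :* a′) := (b :- a) :- t :* (b′ :- a′)) refl
  t (f k) (f (suc k)) (g k) (g (suc k))
  where open ℚ-Solver.+-*-Solver

positive-lower-bound : ∀ (f : Seq) i → 0ℚ < Δ f i → (∀ k → suc k ≡ i → 0ℚ < Δ² f k) →
  ∃ λ δ → 0ℚ < δ × δ ≤ Δ f i × (∀ k → suc k ≡ i → δ ≤ Δ² f k)
positive-lower-bound f zero    0<Δ _    = Δ f 0 , 0<Δ , ≤-refl , λ _ ()
positive-lower-bound f (suc k) 0<Δ 0<Δ² = Δ f (suc k) ⊓ Δ² f k ,
  [ (λ ⊓≡Δ → subst (0ℚ <_) (sym ⊓≡Δ) 0<Δ) , (λ ⊓≡Δ² → subst (0ℚ <_) (sym ⊓≡Δ²) (0<Δ² k refl)) ]′ (⊓-sel (Δ f (suc k)) (Δ² f k)) ,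
  p⊓q≤p (Δ f (suc k)) (Δ² f k) , λ { _ refl → p⊓q≤q (Δ f (suc k)) (Δ² f k) }

-- Sequences standing for vectors with the m + 2 coordinates 0, …, suc m.
NonNegativeOn : ℕ → Seq → Set
NonNegativeOn m f = ∀ j → j ℕ.≤ suc m → 0ℚ ≤ f j

ConvexOn : ℕ → Seq → Set
ConvexOn m f = ∀ k → k ℕ.< m → 0ℚ ≤ Δ² f k

AffineFrom : ℕ → ℕ → Seq → Set
AffineFrom m a f = ∀ k → a ℕ.≤ k → k ℕ.< m → Δ² f k ≡ 0ℚ

ConeOn : ℕ → Seq → Set
ConeOn m f = NonNegativeOn m f × ConvexOn m f

module _ {m : ℕ} {f : Seq} where

  convex⇒Δ-mono : ConvexOn m f → ∀ {k j} → k ℕ.≤ j → j ℕ.≤ m → Δ f k ≤ Δ f j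
  convex⇒Δ-mono cvx {k} = induction-between (λ j → Δ f k ≤ Δ f j) ≤-refl
    λ {j} _ j<m Δfk≤Δfj → ≤-trans Δfk≤Δfj (≤-trans (p≤p+q (cvx j j<m)) (≤-reflexive (sym (Δ-suc f j))))

  Δ-nonNeg⇒mono : ∀ {a} → (∀ k → a ℕ.≤ k → k ℕ.≤ m → 0ℚ ≤ Δ f k) → ∀ {j} → a ℕ.≤ j → j ℕ.≤ suc m → f a ≤ f j
  Δ-nonNeg⇒mono {a} Δ≥0 = induction-between (λ j → f a ≤ f j) ≤-refl
    λ {k} a≤k k<1+m fa≤fk → ≤-trans fa≤fk (≤-trans (p≤p+q (Δ≥0 k a≤k (ℕ.s≤s⁻¹ k<1+m))) (≤-reflexive (sym (step-Δ f k))))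

  Δ≡0⇒const : ∀ {a} → (∀ k → a ℕ.≤ k → k ℕ.≤ m → Δ f k ≡ 0ℚ) → ∀ {j} → a ℕ.≤ j → j ℕ.≤ suc m → f j ≡ f a
  Δ≡0⇒const {a} Δ≡0 = induction-between (λ j → f j ≡ f a) refl
    λ {k} a≤k k<1+m fk≡fa → begin
      f (suc k)    ≡⟨ step-Δ f k ⟩
      f k + Δ f k  ≡⟨ cong₂ _+_ fk≡fa (Δ≡0 k a≤k (ℕ.s≤s⁻¹ k<1+m)) ⟩
      f a + 0ℚ     ≡⟨ +-identityʳ (f a) ⟩
      f a          ∎
    where open ≡-Reasoning

  affine⇒Δ-const : ∀ {a} → AffineFrom m a f → ∀ {k} → a ℕ.≤ k → k ℕ.≤ m → Δ f k ≡ Δ f a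
  affine⇒Δ-const {a} aff = induction-between (λ k → Δ f k ≡ Δ f a) refl
    λ {k} a≤k k<m Δfk≡Δfa → begin
      Δ f (suc k)         ≡⟨ Δ-suc f k ⟩
      Δ f k + Δ² f k      ≡⟨ cong₂ _+_ Δfk≡Δfa (aff k a≤k k<m) ⟩
      Δ f a + 0ℚ          ≡⟨ +-identityʳ (Δ f a) ⟩
      Δ f a               ∎
    where open ≡-Reasoning

  affine-vanishing : ∀ {a} → AffineFrom m a f → f a ≡ 0ℚ → f (suc a) ≡ 0ℚ →
    ∀ {j} → a ℕ.≤ j → j ℕ.≤ suc m → f j ≡ 0ℚ
  affine-vanishing {a} aff fa≡0 f1+a≡0 a≤j j≤1+m =
    trans (Δ≡0⇒const (λ k a≤k k≤m → trans (affine⇒Δ-const aff a≤k k≤m) Δfa≡0) a≤j j≤1+m) fa≡0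
    where
    Δfa≡0 : Δ f a ≡ 0ℚ
    Δfa≡0 rewrite fa≡0 | f1+a≡0 = refl

  convex-flat : ConvexOn m f → Δ f m ≤ 0ℚ → 0ℚ ≤ Δ f 0 → ∀ {j} → j ℕ.≤ suc m → f j ≡ f 0
  convex-flat cvx Δfm≤0 0≤Δf0 = Δ≡0⇒const (λ k _ k≤m → ≤-antisym
    (≤-trans (convex⇒Δ-mono cvx k≤m ℕ.≤-refl) Δfm≤0)
    (≤-trans 0≤Δf0 (convex⇒Δ-mono cvx z≤n k≤m))) z≤n

  -- The last condition says: i = 0, or f has a strict kink at i − 1.
  lastKink : ConvexOn m f → ∃ λ i → i ℕ.≤ m × AffineFrom m i f × (∀ k → suc k ≡ i → 0ℚ < Δ² f k)
  lastKink cvx = search m ℕ.≤-refl (λ k m≤k k<m → ⊥-elim (ℕ.≤⇒≯ m≤k k<m))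
    where
    search : ∀ i → i ℕ.≤ m → AffineFrom m i f →
      ∃ λ i → i ℕ.≤ m × AffineFrom m i f × (∀ k → suc k ≡ i → 0ℚ < Δ² f k)
    search zero    i≤m aff = zero , i≤m , aff , λ _ ()
    search (suc i) i<m aff with Δ² f i ≟ 0ℚ
    ... | no  Δ²≢0 = suc i , i<m , aff , λ { _ refl → ≤∧≢⇒< (cvx i i<m) (≢-sym Δ²≢0) }
    ... | yes Δ²≡0 = search i (ℕ.<⇒≤ i<m) extended
      where
      extended : AffineFrom m i f
      extended k i≤k k<m with ℕ.m≤n⇒m<n∨m≡n i≤k
      ... | inj₁ i<k  = aff k i<k k<m
      ... | inj₂ refl = Δ²≡0

Δ²-cong-on : ∀ {m f g} → (∀ j → j ℕ.≤ suc m → f j ≡ g j) → ∀ {k} → k ℕ.< m → Δ² f k ≡ Δ² g k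
Δ²-cong-on f≈g {k} k<m =
  secondDiff-cong (f≈g k (ℕ.m≤n⇒m≤1+n (ℕ.<⇒≤ k<m))) (f≈g (suc k) (ℕ.m≤n⇒m≤1+n k<m)) (f≈g (suc (suc k)) (s≤s k<m))

coneOn-resp : ∀ {m f g} → (∀ j → j ℕ.≤ suc m → f j ≡ g j) → ConeOn m f → ConeOn m g
coneOn-resp f≈g (nonNeg , cvx) =
  (λ j j≤1+m → subst (0ℚ ≤_) (f≈g j j≤1+m) (nonNeg j j≤1+m)) ,
  (λ k k<m → subst (0ℚ ≤_) (Δ²-cong-on f≈g k<m) (cvx k k<m))

module _ {m : ℕ} {f g r : Seq} (f-cone : ConeOn m f) (g-cone : ConeOn m g)
         (r≡f+g : ∀ j → j ℕ.≤ suc m → r j ≡ f j + g j) where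

  summand-vanishes : ∀ {j} → j ℕ.≤ suc m → r j ≡ 0ℚ → f j ≡ 0ℚ
  summand-vanishes {j} j≤1+m rj≡0 =
    nonNeg+nonNeg≡0⇒≡0 (proj₁ f-cone j j≤1+m) (proj₁ g-cone j j≤1+m) (trans (sym (r≡f+g j j≤1+m)) rj≡0)

  summand-affine : ∀ {a} → AffineFrom m a r → AffineFrom m a f
  summand-affine r-affine k a≤k k<m = nonNeg+nonNeg≡0⇒≡0 (proj₂ f-cone k k<m) (proj₂ g-cone k k<m) (begin
    Δ² f k + Δ² g k         ≡⟨ secondDiff-+ (f k) (f (suc k)) (f (suc (suc k))) (g k) (g (suc k)) (g (suc (suc k))) ⟨
    Δ² (λ j → f j + g j) k  ≡⟨ Δ²-cong-on r≡f+g k<m ⟨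
    Δ² r k                  ≡⟨ r-affine k a≤k k<m ⟩
    0ℚ                      ∎)
    where open ≡-Reasoning

clamp : ∀ n → ℕ → Fin (suc n)
clamp zero    _       = Fin.zero
clamp (suc n) zero    = Fin.zero
clamp (suc n) (suc j) = Fin.suc (clamp n j)

toℕ-clamp : ∀ {n j} → j ℕ.≤ n → toℕ (clamp n j) ≡ j
toℕ-clamp {zero}  z≤n       = refl
toℕ-clamp {suc n} {zero}  _ = refl
toℕ-clamp {suc n} {suc j} (s≤s j≤n) = cong suc (toℕ-clamp j≤n)

clamp-toℕ : ∀ {n} {J : Fin (suc n)} {j} → toℕ J ≡ j → clamp n j ≡ J
clamp-toℕ {J = J} refl = Fin.toℕ-injective (toℕ-clamp (Fin.toℕ≤pred[n] J))

-- Beyond the last index toSeq repeats the last coordinate; only the values at 0, …, suc m are used.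
toSeq : ∀ {m} → Vecℚ (suc (suc m)) → Seq
toSeq {m} v j = v (clamp (suc m) j)

module _ {m : ℕ} (v : Vecℚ (suc (suc m))) where

  toSeq-toℕ : ∀ {J j} → toℕ J ≡ j → toSeq v j ≡ v J
  toSeq-toℕ toℕJ≡j = cong v (clamp-toℕ toℕJ≡j)

  Δ²-toSeq : ∀ (i : Fin m) →
    Δ² (toSeq v) (toℕ i) ≡ secondDiff (v (inject₁ (inject₁ i))) (v (Fin.suc (inject₁ i))) (v (Fin.suc (Fin.suc i)))
  Δ²-toSeq i = secondDiff-cong
    (toSeq-toℕ (trans (Fin.toℕ-inject₁ (inject₁ i)) (Fin.toℕ-inject₁ i)))
    (toSeq-toℕ (cong suc (Fin.toℕ-inject₁ i)))
    (toSeq-toℕ refl)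

  inCone⇒coneOn : InCone m v → ConeOn m (toSeq v)
  inCone⇒coneOn (pos , cvx) = (λ j _ → pos _) , λ k k<m →
    subst (0ℚ ≤_) (trans (sym (Δ²-toSeq (Fin.fromℕ< k<m))) (cong (Δ² (toSeq v)) (Fin.toℕ-fromℕ< k<m))) (cvx (Fin.fromℕ< k<m))

  coneOn⇒inCone : ConeOn m (toSeq v) → InCone m v
  coneOn⇒inCone (nonNeg , cvx) =
    (λ J → subst (0ℚ ≤_) (toSeq-toℕ refl) (nonNeg (toℕ J) (Fin.toℕ≤pred[n] J))) ,
    (λ i → subst (0ℚ ≤_) (Δ²-toSeq i) (cvx (toℕ i) (Fin.toℕ<n i)))

  toSeq-reverse : ∀ j → j ℕ.≤ suc m → toSeq (reverse v) j ≡ toSeq v (suc m ∸ j)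
  toSeq-reverse j j≤1+m = sym (toSeq-toℕ (trans (Fin.opposite-prop (clamp (suc m) j)) (cong (suc m ∸_) (toℕ-clamp j≤1+m))))

-- The ramps a⁽ⁱ⁾

-- ramp m i is a⁽ⁱ⁺¹⁾ on 0-based indices (n = m + 2); truncated subtraction supplies the max(0, ·).
ramp : ℕ → ℕ → Seq
ramp m i j = + (j ∸ i) / suc (m ∸ i)

module _ (m i : ℕ) where

  ramp-nonNeg : ∀ j → 0ℚ ≤ ramp m i j
  ramp-nonNeg j = nonNegative⁻¹ _ {{normalize-nonNeg (j ∸ i) (suc (m ∸ i))}}

  ramp-zero : ∀ {j} → j ℕ.≤ i → ramp m i j ≡ 0ℚ
  ramp-zero j≤i rewrite ℕ.m≤n⇒m∸n≡0 j≤i = 0/n≡0 (suc (m ∸ i))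

  ramp-pos : ∀ {j} → i ℕ.< j → 0ℚ < ramp m i j
  ramp-pos {j} i<j rewrite ℕ.+-∸-assoc 1 i<j = positive⁻¹ _ {{normalize-pos (suc (j ∸ suc i)) (suc (m ∸ i))}}

  Δ²-ramp-kink : ∀ {k} → suc k ≡ i → Δ² (ramp m i) k ≡ ramp m i (suc i)
  Δ²-ramp-kink {k} refl = begin
    secondDiff (ramp m i k) (ramp m i i) (ramp m i (suc i))  ≡⟨ secondDiff-cong (ramp-zero (ℕ.n≤1+n k)) (ramp-zero ℕ.≤-refl) refl ⟩
    secondDiff 0ℚ 0ℚ (ramp m i (suc i))                      ≡⟨ solve 1 (λ c → (con 0ℚ :+ c) :- (con 0ℚ :+ con 0ℚ) := c) refl _ ⟩
    ramp m i (suc i)                                         ∎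
    where
    open ≡-Reasoning
    open ℚ-Solver.+-*-Solver

  Δ²-ramp-before : ∀ {k} → suc k ℕ.< i → Δ² (ramp m i) k ≡ 0ℚ
  Δ²-ramp-before {k} 1+k<i =
    secondDiff-cong (ramp-zero (ℕ.<⇒≤ (ℕ.<-trans (ℕ.n<1+n k) 1+k<i))) (ramp-zero (ℕ.<⇒≤ 1+k<i)) (ramp-zero 1+k<i)

  Δ²-ramp-after : ∀ {k} → i ℕ.≤ k → Δ² (ramp m i) k ≡ 0ℚ
  Δ²-ramp-after {k} i≤k = begin
    Δ² (ramp m i) k                            ≡⟨ cong₂ _-_ (+a/n++b/n≡+[a+b]/n r₀ r₂ _) (+a/n++b/n≡+[a+b]/n r₁ r₁ _) ⟩
    + (r₀ ℕ.+ r₂) / d - + (r₁ ℕ.+ r₁) / d      ≡⟨ cong (λ n → + n / d - + (r₁ ℕ.+ r₁) / d) linear ⟩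
    + (r₁ ℕ.+ r₁) / d - + (r₁ ℕ.+ r₁) / d      ≡⟨ +-inverseʳ (+ (r₁ ℕ.+ r₁) / d) ⟩
    0ℚ                                         ∎
    where
    open ≡-Reasoning
    d  = suc (m ∸ i)
    r₀ = k ∸ i
    r₁ = suc k ∸ i
    r₂ = suc (suc k) ∸ i
    linear : r₀ ℕ.+ r₂ ≡ r₁ ℕ.+ r₁
    linear rewrite ℕ.+-∸-assoc 2 i≤k | ℕ.+-∸-assoc 1 i≤k = ℕ.+-suc (k ∸ i) (suc (k ∸ i))

  Δ²-ramp-off : ∀ {k} → suc k ≢ i → Δ² (ramp m i) k ≡ 0ℚ
  Δ²-ramp-off {k} 1+k≢i =
    [ (λ 1+k≤i → Δ²-ramp-before (ℕ.≤∧≢⇒< 1+k≤i 1+k≢i))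
    , (λ i≤1+k → Δ²-ramp-after (ℕ.s≤s⁻¹ (ℕ.≤∧≢⇒< i≤1+k (≢-sym 1+k≢i)))) ]′
    (ℕ.≤-total (suc k) i)

  Δ-ramp : Δ (ramp m i) i ≡ ramp m i (suc i)
  Δ-ramp = trans (cong (λ a → ramp m i (suc i) - a) (ramp-zero ℕ.≤-refl)) (+-identityʳ _)

  0<slope : 0ℚ < ramp m i (suc i)
  0<slope = ramp-pos (ℕ.n<1+n i)

  ramp-coneOn : ConeOn m (ramp m i)
  ramp-coneOn = (λ j _ → ramp-nonNeg j) , λ k _ → Δ²-ramp-nonNeg k
    where
    Δ²-ramp-nonNeg : ∀ k → 0ℚ ≤ Δ² (ramp m i) k
    Δ²-ramp-nonNeg k = [ (λ 1+k≡i → subst (0ℚ ≤_) (sym (Δ²-ramp-kink 1+k≡i)) (ramp-nonNeg (suc i)))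
                       , (λ 1+k≢i → ≤-reflexive (sym (Δ²-ramp-off 1+k≢i))) ]′ (toSum (suc k ℕ.≟ i))

  ramp-summand : ∀ {f g} → i ℕ.≤ m → ConeOn m f → ConeOn m g → (∀ j → j ℕ.≤ suc m → ramp m i j ≡ f j + g j) →
    ∀ j → j ℕ.≤ suc m → f j ≡ (f (suc i) * recip 0<slope) * ramp m i j
  ramp-summand {f} i≤m f-cone g-cone ramp≡f+g j j≤1+m = [ below , above ]′ (ℕ.≤-total j i)
    where
    c = f (suc i) * recip 0<slope
    f-vanishes : ∀ {j} → j ℕ.≤ i → j ℕ.≤ suc m → f j ≡ 0ℚ
    f-vanishes j≤i j≤1+m = summand-vanishes f-cone g-cone ramp≡f+g j≤1+m (ramp-zero j≤i)
    below : j ℕ.≤ i → f j ≡ c * ramp m i j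
    below j≤i = begin
      f j             ≡⟨ f-vanishes j≤i j≤1+m ⟩
      0ℚ              ≡⟨ *-zeroʳ c ⟨
      c * 0ℚ          ≡⟨ cong (c *_) (ramp-zero j≤i) ⟨
      c * ramp m i j  ∎
      where open ≡-Reasoning
    h : Seq
    h j = f j - c * ramp m i j
    h-affine : AffineFrom m i h
    h-affine k i≤k k<m = begin
      Δ² h k                        ≡⟨ secondDiff-sub-* c (f k) (f (suc k)) (f (suc (suc k))) _ _ _ ⟩
      Δ² f k - c * Δ² (ramp m i) k  ≡⟨ cong₂ (λ a b → a - c * b) (f-affine k i≤k k<m) (Δ²-ramp-after i≤k) ⟩
      0ℚ - c * 0ℚ                   ≡⟨ cong (λ a → 0ℚ - a) (*-zeroʳ c) ⟩
      0ℚ                            ∎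
      where
      open ≡-Reasoning
      f-affine = summand-affine f-cone g-cone ramp≡f+g (λ _ i≤k _ → Δ²-ramp-after i≤k)
    h-at-i : h i ≡ 0ℚ
    h-at-i rewrite f-vanishes ℕ.≤-refl (ℕ.m≤n⇒m≤1+n i≤m) | ramp-zero ℕ.≤-refl | *-zeroʳ c = refl
    h-at-1+i : h (suc i) ≡ 0ℚ
    h-at-1+i = trans (cong (λ a → f (suc i) - a) (*-recip-cancelʳ 0<slope (f (suc i)))) (+-inverseʳ (f (suc i)))
    above : i ℕ.≤ j → f j ≡ c * ramp m i j
    above i≤j = p-q≡0⇒p≡q (affine-vanishing {f = h} h-affine h-at-i h-at-1+i i≤j j≤1+m)

  -- Subtraction lowers Δ² f only at i − 1 and Δ f only from i on, both by t · ramp m i (suc i).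
  ramp-peel : ∀ {f t} → i ℕ.≤ m → ConeOn m f → t * ramp m i (suc i) ≤ Δ f i →
    (∀ k → suc k ≡ i → t * ramp m i (suc i) ≤ Δ² f k) → ConeOn m (λ j → f j - t * ramp m i j)
  ramp-peel {f} {t} i≤m (f≥0 , f-cvx) slope≤Δ slope≤Δ² = y≥0 , y-cvx
    where
    y : Seq
    y j = f j - t * ramp m i j
    Δ²y≡ : ∀ k → Δ² y k ≡ Δ² f k - t * Δ² (ramp m i) k
    Δ²y≡ k = secondDiff-sub-* t (f k) (f (suc k)) (f (suc (suc k))) _ _ _
    y-cvx : ConvexOn m y
    y-cvx k k<m = [ (λ 1+k≡i → subst (0ℚ ≤_) (sym (trans (Δ²y≡ k) (cong (λ a → Δ² f k - t * a) (Δ²-ramp-kink 1+k≡i))))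
                                     (p≤q⇒0≤q-p (slope≤Δ² k 1+k≡i)))
                  , (λ 1+k≢i → subst (0ℚ ≤_)
                                     (sym (trans (Δ²y≡ k) (trans (cong (λ a → Δ² f k - t * a) (Δ²-ramp-off 1+k≢i)) (p-q*0≡p (Δ² f k) t))))
                                     (f-cvx k k<m)) ]′ (toSum (suc k ℕ.≟ i))
    y≡f : ∀ {j} → j ℕ.≤ i → y j ≡ f j
    y≡f {j} j≤i = trans (cong (λ a → f j - t * a) (ramp-zero j≤i)) (p-q*0≡p (f j) t)
    0≤Δy : 0ℚ ≤ Δ y i
    0≤Δy = subst (0ℚ ≤_) (sym (trans (Δ-sub-* f (ramp m i) t i) (cong (λ a → Δ f i - t * a) Δ-ramp)))
                 (p≤q⇒0≤q-p slope≤Δ)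
    0≤yi : 0ℚ ≤ y i
    0≤yi = subst (0ℚ ≤_) (sym (y≡f ℕ.≤-refl)) (f≥0 i (ℕ.m≤n⇒m≤1+n i≤m))
    y≥0 : NonNegativeOn m y
    y≥0 j j≤1+m = [ (λ j≤i → subst (0ℚ ≤_) (sym (y≡f j≤i)) (f≥0 j j≤1+m))
                  , (λ i≤j → ≤-trans 0≤yi (Δ-nonNeg⇒mono {f = y}
                       (λ k i≤k k≤m → ≤-trans 0≤Δy (convex⇒Δ-mono {f = y} y-cvx i≤k k≤m)) i≤j j≤1+m)) ]′ (ℕ.≤-total j i)

module _ (m : ℕ) (i : Fin (suc m)) where

  vecA≡ramp : ∀ J → vecA m i J ≡ ramp m (toℕ i) (toℕ J)
  vecA≡ramp J = [ (λ J≤i → trans (p≥q⇒p⊔q≡p (nonPos/n≤0 _ (m ∸ toℕ i) (ℤ.i≤j⇒i-j≤0 (ℤ.+≤+ J≤i))))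
                                  (sym (ramp-zero m (toℕ i) J≤i)))
                , (λ i≤J → trans (cong (λ n → 0ℚ ⊔ (n / suc (m ∸ toℕ i))) (sym (+[m∸n]≡+m-+n i≤J)))
                                  (p≤q⇒p⊔q≡q (ramp-nonNeg m (toℕ i) (toℕ J)))) ]′ (ℕ.≤-total (toℕ J) (toℕ i))

  toSeq-vecA : ∀ j → j ℕ.≤ suc m → toSeq (vecA m i) j ≡ ramp m (toℕ i) j
  toSeq-vecA j j≤1+m = trans (vecA≡ramp _) (cong (ramp m (toℕ i)) (toℕ-clamp j≤1+m))

  vecB≡reverse-vecA : ∀ J → vecB m i J ≡ reverse (vecA m i) J
  vecB≡reverse-vecA J = cong (λ n → 0ℚ ⊔ (n / suc (m ∸ toℕ i))) (begin
    + suc m ℤ.- + toℕ i ℤ.- + toℕ J      ≡⟨ solve 3 (λ a b c → a :- b :- c := (a :- c) :- b) refl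
                                                   (+ suc m) (+ toℕ i) (+ toℕ J) ⟩
    (+ suc m ℤ.- + toℕ J) ℤ.- + toℕ i    ≡⟨ cong (ℤ._- + toℕ i) (sym (+[m∸n]≡+m-+n (Fin.toℕ≤pred[n] J))) ⟩
    + (suc m ∸ toℕ J) ℤ.- + toℕ i        ≡⟨ cong (λ n → + n ℤ.- + toℕ i) (sym (Fin.opposite-prop J)) ⟩
    + toℕ (opposite J) ℤ.- + toℕ i       ∎)
    where
    open ≡-Reasoning
    open ℤ-Solver.+-*-Solver

vecA+vecB≡1 : ∀ m J → vecA m Fin.zero J + vecB m Fin.zero J ≡ 1ℚ
vecA+vecB≡1 m J = begin
  vecA m Fin.zero J + vecB m Fin.zero J                  ≡⟨ cong₂ _+_ (vecA≡ramp m Fin.zero J)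
                                                              (trans (vecB≡reverse-vecA m Fin.zero J) (vecA≡ramp m Fin.zero (opposite J))) ⟩
  + toℕ J / suc m + + toℕ (opposite J) / suc m           ≡⟨ +a/n++b/n≡+[a+b]/n (toℕ J) _ m ⟩
  + (toℕ J ℕ.+ toℕ (opposite J)) / suc m                 ≡⟨ cong (λ n → + (toℕ J ℕ.+ n) / suc m) (Fin.opposite-prop J) ⟩
  + (toℕ J ℕ.+ (suc m ∸ toℕ J)) / suc m                  ≡⟨ cong (λ n → + n / suc m) (ℕ.m+[n∸m]≡n (Fin.toℕ≤pred[n] J)) ⟩
  + suc m / suc m                                        ≡⟨ +n/n≡1 m ⟩
  1ℚ                                                     ∎
  where open ≡-Reasoning

-- Reversal

opposite-inject₁ : ∀ {n} (i : Fin n) → opposite (inject₁ i) ≡ Fin.suc (opposite i)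
opposite-inject₁ Fin.zero    = refl
opposite-inject₁ (Fin.suc i) = cong inject₁ (opposite-inject₁ i)

module _ {m : ℕ} where

  inCone-resp : ∀ {u v : Vecℚ (suc (suc m))} → u ≗ v → InCone m u → InCone m v
  inCone-resp u≗v (pos , cvx) =
    (λ J → subst (0ℚ ≤_) (u≗v J) (pos J)) ,
    (λ i → subst (0ℚ ≤_) (secondDiff-cong (u≗v _) (u≗v _) (u≗v _)) (cvx i))

  inCone-scale : ∀ {t} {v : Vecℚ (suc (suc m))} → 0ℚ ≤ t → InCone m v → InCone m (λ J → t * v J)
  inCone-scale {t} 0≤t (pos , cvx) =
    (λ J → 0≤* 0≤t (pos J)) ,
    (λ i → subst (0ℚ ≤_) (sym (secondDiff-* t _ _ _)) (0≤* 0≤t (cvx i)))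

  inCone-reverse : ∀ {v : Vecℚ (suc (suc m))} → InCone m v → InCone m (reverse v)
  inCone-reverse {v} (pos , cvx) = pos ∘ opposite , reversed
    where
    opposite-ιι : ∀ (i : Fin m) → opposite (inject₁ (inject₁ i)) ≡ Fin.suc (Fin.suc (opposite i))
    opposite-ιι i = trans (opposite-inject₁ (inject₁ i)) (cong Fin.suc (opposite-inject₁ i))
    opposite-sι : ∀ (i : Fin m) → opposite (Fin.suc (inject₁ i)) ≡ Fin.suc (inject₁ (opposite i))
    opposite-sι i = cong inject₁ (opposite-inject₁ i)
    reversed : Convex m (reverse v)
    reversed i = subst (0ℚ ≤_)
      (trans (secondDiff-comm (v (inject₁ (inject₁ (opposite i)))) (v (Fin.suc (inject₁ (opposite i))))
                              (v (Fin.suc (Fin.suc (opposite i)))))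
             (secondDiff-cong (cong v (sym (opposite-ιι i))) (cong v (sym (opposite-sι i))) refl))
      (cvx (opposite i))

  sameRay-resp : ∀ {u u′ v v′ : Vecℚ (suc (suc m))} → u ≗ u′ → v ≗ v′ → SameRay u v → SameRay u′ v′
  sameRay-resp u≗u′ v≗v′ (c , 0<c , u≡c·v) =
    c , 0<c , λ J → trans (sym (u≗u′ J)) (trans (u≡c·v J) (cong (c *_) (v≗v′ J)))

  sameRay-reverse : ∀ {u v : Vecℚ (suc (suc m))} → SameRay u v → SameRay (reverse u) (reverse v)
  sameRay-reverse (c , 0<c , u≡c·v) = c , 0<c , u≡c·v ∘ opposite

  extreme-resp : ∀ {u v : Vecℚ (suc (suc m))} → u ≗ v → SpansExtremeRay m u → SpansExtremeRay m v
  extreme-resp {u} {v} u≗v (cone , (J , uJ≢0) , split) =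
    inCone-resp u≗v cone , (J , uJ≢0 ∘ trans (u≗v J)) , λ x y cx cy v≡x+y →
      let (x∼u , y∼u) = split x y cx cy (λ J → trans (u≗v J) (v≡x+y J)) in
      along x∼u , along y∼u
    where
    along : ∀ {x} → (∃ λ c → 0ℚ ≤ c × (x ≡ c · u)) → ∃ λ c → 0ℚ ≤ c × (x ≡ c · v)
    along (c , 0≤c , x≡c·u) = c , 0≤c , λ J → trans (x≡c·u J) (cong (c *_) (u≗v J))

  extreme-reverse : ∀ {v : Vecℚ (suc (suc m))} → SpansExtremeRay m v → SpansExtremeRay m (reverse v)
  extreme-reverse {v} (cone , (J , vJ≢0) , split) =
    inCone-reverse cone , (opposite J , vJ≢0 ∘ trans (cong v (sym (Fin.opposite-involutive J)))) , λ x y cx cy v′≡x+y →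
      let (x′∼v , y′∼v) = split (reverse x) (reverse y) (inCone-reverse cx) (inCone-reverse cy)
                            (λ J → trans (cong v (sym (Fin.opposite-involutive J))) (v′≡x+y (opposite J))) in
      unreverse x′∼v , unreverse y′∼v
    where
    unreverse : ∀ {x} → (∃ λ c → 0ℚ ≤ c × (reverse x ≡ c · v)) → ∃ λ c → 0ℚ ≤ c × (x ≡ c · reverse v)
    unreverse {x} (c , 0≤c , x′≡c·v) =
      c , 0≤c , λ J → trans (cong x (sym (Fin.opposite-involutive J))) (x′≡c·v (opposite J))

-- Extremality of the generators

module _ {m : ℕ} (i : Fin (suc m)) where

  vecA-zero : ∀ J → toℕ J ℕ.≤ toℕ i → vecA m i J ≡ 0ℚ
  vecA-zero J J≤i = trans (vecA≡ramp m i J) (ramp-zero m (toℕ i) J≤i)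

  vecA-pos : ∀ J → toℕ i ℕ.< toℕ J → 0ℚ < vecA m i J
  vecA-pos J i<J = subst (0ℚ <_) (sym (vecA≡ramp m i J)) (ramp-pos m (toℕ i) i<J)

  vecA-last-pos : 0ℚ < vecA m i (Fin.fromℕ (suc m))
  vecA-last-pos =
    vecA-pos (Fin.fromℕ (suc m)) (subst (toℕ i ℕ.<_) (sym (Fin.toℕ-fromℕ (suc m))) (s≤s (Fin.toℕ≤pred[n] i)))

  vecB-first-pos : 0ℚ < vecB m i Fin.zero
  vecB-first-pos = subst (0ℚ <_) (sym (vecB≡reverse-vecA m i Fin.zero)) vecA-last-pos

  vecA-inCone : InCone m (vecA m i)
  vecA-inCone =
    coneOn⇒inCone (vecA m i) (coneOn-resp (λ j j≤1+m → sym (toSeq-vecA m i j j≤1+m)) (ramp-coneOn m (toℕ i)))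

  vecA-nonZero : NonZero (vecA m i)
  vecA-nonZero = Fin.fromℕ (suc m) , ≢-sym (<⇒≢ vecA-last-pos)

  vecA-extreme : SpansExtremeRay m (vecA m i)
  vecA-extreme = vecA-inCone , vecA-nonZero , λ x y cx cy a≡x+y →
    summand cx cy a≡x+y , summand cy cx (λ J → trans (a≡x+y J) (+-comm (x J) (y J)))
    where
    summand : ∀ {x y} → InCone m x → InCone m y → (∀ J → vecA m i J ≡ x J + y J) →
      ∃ λ c → 0ℚ ≤ c × (x ≡ c · vecA m i)
    summand {x} {y} cx cy a≡x+y = c , 0≤c , λ J → begin
      x J                             ≡⟨ toSeq-toℕ x refl ⟨
      toSeq x (toℕ J)                 ≡⟨ x≡c·ramp (toℕ J) (Fin.toℕ≤pred[n] J) ⟩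
      c * ramp m (toℕ i) (toℕ J)      ≡⟨ cong (c *_) (vecA≡ramp m i J) ⟨
      c * vecA m i J                  ∎
      where
      open ≡-Reasoning
      x≡c·ramp = ramp-summand m (toℕ i) (Fin.toℕ≤pred[n] i) (inCone⇒coneOn x cx) (inCone⇒coneOn y cy)
        (λ j j≤1+m → trans (sym (toSeq-vecA m i j j≤1+m)) (a≡x+y (clamp (suc m) j)))
      c = toSeq x (suc (toℕ i)) * recip (0<slope m (toℕ i))
      0≤c : 0ℚ ≤ c
      0≤c = 0≤* (proj₁ cx _) (<⇒≤ (recip-pos (0<slope m (toℕ i))))

  vecB-extreme : SpansExtremeRay m (vecB m i)
  vecB-extreme = extreme-resp (λ J → sym (vecB≡reverse-vecA m i J)) (extreme-reverse vecA-extreme)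

-- Every extreme ray is spanned by a generator

module _ {m : ℕ} {v g : Vecℚ (suc (suc m))} where

  peel : SpansExtremeRay m v → InCone m g → NonZero g →
    ∀ {t} → 0ℚ < t → InCone m (λ J → v J - t * g J) → SameRay v g
  peel (_ , _ , split) cg (J₀ , gJ₀≢0) {t} 0<t cy = recip 0<λ * t , 0<* (recip-pos 0<λ) 0<t , v≡c·g
    where
    x : Vecℚ (suc (suc m))
    x J = t * g J
    x∼v = proj₁ (split x (λ J → v J - t * g J) (inCone-scale (<⇒≤ 0<t) cg) cy
                   (λ J → solve 2 (λ a b → a := b :+ (a :- b)) refl (v J) (x J)))
      where open ℚ-Solver.+-*-Solver
    λ′ = proj₁ x∼v
    x≡λ·v = proj₂ (proj₂ x∼v)
    0<λ : 0ℚ < λ′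
    0<λ = ≤∧≢⇒< (proj₁ (proj₂ x∼v)) λ 0≡λ → <⇒≢ (0<* 0<t (≤∧≢⇒< (proj₁ cg J₀) (≢-sym gJ₀≢0)))
      (sym (trans (x≡λ·v J₀) (trans (cong (_* v J₀) (sym 0≡λ)) (*-zeroˡ (v J₀)))))
    v≡c·g : v ≡ (recip 0<λ * t) · g
    v≡c·g J = begin
      v J                     ≡⟨ recip-*-cancelˡ 0<λ (v J) ⟨
      recip 0<λ * (λ′ * v J)  ≡⟨ cong (recip 0<λ *_) (x≡λ·v J) ⟨
      recip 0<λ * (t * g J)   ≡⟨ *-assoc (recip 0<λ) t (g J) ⟨
      recip 0<λ * t * g J     ∎
      where open ≡-Reasoning

module _ {m : ℕ} {v : Vecℚ (suc (suc m))} where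

  vecA-peelable : InCone m v → ∀ {i} (i≤m : i ℕ.≤ m) →
    0ℚ < Δ (toSeq v) i → (∀ k → suc k ≡ i → 0ℚ < Δ² (toSeq v) k) →
    ∃ λ t → 0ℚ < t × InCone m (λ J → v J - t * vecA m (Fin.fromℕ< (s≤s i≤m)) J)
  vecA-peelable cone {i} i≤m 0<Δi kink = t , 0<* 0<δ (recip-pos (0<slope m i)) ,
    coneOn⇒inCone _ (coneOn-resp agree (ramp-peel m i {f} {t} i≤m (inCone⇒coneOn v cone) slope≤Δ slope≤Δ²))
    where
    f = toSeq v
    bound = positive-lower-bound f i 0<Δi kink
    δ = proj₁ bound
    0<δ = proj₁ (proj₂ bound)
    t = δ * recip (0<slope m i)
    t*slope≡δ : t * ramp m i (suc i) ≡ δ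
    t*slope≡δ = *-recip-cancelʳ (0<slope m i) δ
    slope≤Δ : t * ramp m i (suc i) ≤ Δ f i
    slope≤Δ = subst (_≤ Δ f i) (sym t*slope≡δ) (proj₁ (proj₂ (proj₂ bound)))
    slope≤Δ² : ∀ k → suc k ≡ i → t * ramp m i (suc i) ≤ Δ² f k
    slope≤Δ² k 1+k≡i = subst (_≤ Δ² f k) (sym t*slope≡δ) (proj₂ (proj₂ (proj₂ bound)) k 1+k≡i)
    I = Fin.fromℕ< (s≤s i≤m)
    agree : ∀ j → j ℕ.≤ suc m → f j - t * ramp m i j ≡ toSeq (λ J → v J - t * vecA m I J) j
    agree j j≤1+m = cong (λ a → f j - t * a)
      (sym (trans (toSeq-vecA m I j j≤1+m) (cong (λ i → ramp m i j) (Fin.toℕ-fromℕ< (s≤s i≤m)))))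

  lastSlope-pos⇒ray-of-vecA : SpansExtremeRay m v → 0ℚ < Δ (toSeq v) m → ∃ λ i → SameRay v (vecA m i)
  lastSlope-pos⇒ray-of-vecA ev@(cone , _) 0<Δm =
    let (i , i≤m , affine , kink) = lastKink {f = toSeq v} (proj₂ (inCone⇒coneOn v cone))
        0<Δi = subst (0ℚ <_) (affine⇒Δ-const {f = toSeq v} affine i≤m ℕ.≤-refl) 0<Δm
        (t , 0<t , remainder-inCone) = vecA-peelable cone i≤m 0<Δi kink
        I = Fin.fromℕ< (s≤s i≤m)
    in I , peel ev (vecA-inCone I) (vecA-nonZero I) 0<t remainder-inCone

  constant-not-extreme : SpansExtremeRay m v → (∀ J → v J ≡ v Fin.zero) → ⊥
  constant-not-extreme ev@(cone , (J , vJ≢0) , _) v-const = <⇒≢ 0<c (sym v₀≡0)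
    where
    c = v Fin.zero
    0<c : 0ℚ < c
    0<c = ≤∧≢⇒< (proj₁ cone Fin.zero) (λ 0≡c → vJ≢0 (trans (v-const J) (sym 0≡c)))
    remainder≡c·vecB : (λ J → c * vecB m Fin.zero J) ≗ (λ J → v J - c * vecA m Fin.zero J)
    remainder≡c·vecB J = begin
      c * b                    ≡⟨ solve 3 (λ c a b → c :* b := c :* (a :+ b) :- c :* a) refl c a b ⟩
      c * (a + b) - c * a      ≡⟨ cong (λ s → c * s - c * a) (vecA+vecB≡1 m J) ⟩
      c * 1ℚ - c * a           ≡⟨ cong (λ s → s - c * a) (trans (*-identityʳ c) (sym (v-const J))) ⟩
      v J - c * a              ∎
      where
      open ≡-Reasoning
      open ℚ-Solver.+-*-Solver
      a = vecA m Fin.zero J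
      b = vecB m Fin.zero J
    ray : SameRay v (vecA m Fin.zero)
    ray = peel ev (vecA-inCone Fin.zero) (vecA-nonZero Fin.zero) 0<c
      (inCone-resp remainder≡c·vecB (inCone-scale (<⇒≤ 0<c) (proj₁ (vecB-extreme Fin.zero))))
    v₀≡0 : v Fin.zero ≡ 0ℚ
    v₀≡0 = let (c′ , _ , v≡c′·a) = ray in
      trans (v≡c′·a Fin.zero) (trans (cong (c′ *_) (vecA-zero {m} Fin.zero Fin.zero z≤n)) (*-zeroʳ c′))

  Δ-reverse-last : Δ (toSeq (reverse v)) m ≡ - Δ (toSeq v) 0
  Δ-reverse-last = begin
    toSeq (reverse v) (suc m) - toSeq (reverse v) m  ≡⟨ cong₂ _-_ (trans (toSeq-reverse v (suc m) ℕ.≤-refl) (cong (toSeq v) (ℕ.n∸n≡0 (suc m))))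
                                                                  (trans (toSeq-reverse v m (ℕ.n≤1+n m)) (cong (toSeq v) (ℕ.m+n∸n≡m 1 m))) ⟩
    toSeq v 0 - toSeq v 1                            ≡⟨ solve 2 (λ a b → a :- b := :- (b :- a)) refl (toSeq v 0) (toSeq v 1) ⟩
    - Δ (toSeq v) 0                                  ∎
    where
    open ≡-Reasoning
    open ℚ-Solver.+-*-Solver

extreme⇒ray-of-generator : ∀ {m} {v : Vecℚ (suc (suc m))} → SpansExtremeRay m v → ∃ λ k → SameRay v (gen m k)
extreme⇒ray-of-generator {m} {v} ev = bySlopes (0ℚ <? Δ (toSeq v) m) (Δ (toSeq v) 0 <? 0ℚ)
  where
  bySlopes : Dec (0ℚ < Δ (toSeq v) m) → Dec (Δ (toSeq v) 0 < 0ℚ) → ∃ λ k → SameRay v (gen m k)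
  bySlopes (yes 0<Δm) _ = let (i , ray) = lastSlope-pos⇒ray-of-vecA ev 0<Δm in inj₁ i , ray
  bySlopes (no _) (yes Δ₀<0) =
    let (i , ray) = lastSlope-pos⇒ray-of-vecA (extreme-reverse ev)
                      (subst (0ℚ <_) (sym (Δ-reverse-last {v = v})) (neg-antimono-< Δ₀<0))
    in inj₂ i , sameRay-resp (cong v ∘ Fin.opposite-involutive) (sym ∘ vecB≡reverse-vecA m i) (sameRay-reverse ray)
  bySlopes (no Δm≯0) (no Δ₀≮0) = ⊥-elim (constant-not-extreme ev λ J →
    trans (sym (toSeq-toℕ v refl))
          (convex-flat {f = toSeq v} (proj₂ (inCone⇒coneOn v (proj₁ ev))) (≮⇒≥ Δm≯0) (≮⇒≥ Δ₀≮0) (Fin.toℕ≤pred[n] J)))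

-- Distinct generators span distinct rays

module _ {m : ℕ} {u v : Vecℚ (suc (suc m))} where

  sameRay-zeroˡ : SameRay u v → ∀ J → v J ≡ 0ℚ → u J ≡ 0ℚ
  sameRay-zeroˡ (c , _ , u≡c·v) J vJ≡0 = trans (u≡c·v J) (trans (cong (c *_) vJ≡0) (*-zeroʳ c))

  sameRay-zeroʳ : SameRay u v → ∀ J → u J ≡ 0ℚ → v J ≡ 0ℚ
  sameRay-zeroʳ (c , 0<c , u≡c·v) J uJ≡0 = begin
    v J                    ≡⟨ recip-*-cancelˡ 0<c (v J) ⟨
    recip 0<c * (c * v J)  ≡⟨ cong (recip 0<c *_) (trans (sym (u≡c·v J)) uJ≡0) ⟩
    recip 0<c * 0ℚ         ≡⟨ *-zeroʳ (recip 0<c) ⟩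
    0ℚ                     ∎
    where open ≡-Reasoning

module _ {m : ℕ} where

  vecA-ray-injective : ∀ {i i′ : Fin (suc m)} → SameRay (vecA m i) (vecA m i′) → i ≡ i′
  vecA-ray-injective {i} {i′} ray =
    Fin.toℕ-injective (ℕ.≤-antisym (shared-zeros⇒≤ i i′ (sameRay-zeroʳ ray)) (shared-zeros⇒≤ i′ i (sameRay-zeroˡ ray)))
    where
    shared-zeros⇒≤ : ∀ i i′ → (∀ J → vecA m i J ≡ 0ℚ → vecA m i′ J ≡ 0ℚ) → toℕ i ℕ.≤ toℕ i′
    shared-zeros⇒≤ i i′ zeros-shared = subst (ℕ._≤ toℕ i′) (Fin.toℕ-inject₁ i) (ℕ.≮⇒≥ λ i′<i →
      <⇒≢ (vecA-pos i′ (inject₁ i) i′<i)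
          (sym (zeros-shared (inject₁ i) (vecA-zero i (inject₁ i) (ℕ.≤-reflexive (Fin.toℕ-inject₁ i))))))

  gen-ray-injective : ∀ (k k′ : Fin (suc m) ⊎ Fin (suc m)) → SameRay (gen m k) (gen m k′) → k ≡ k′
  gen-ray-injective (inj₁ i) (inj₁ i′) ray = cong inj₁ (vecA-ray-injective ray)
  gen-ray-injective (inj₁ i) (inj₂ i′) ray =
    ⊥-elim (<⇒≢ (vecB-first-pos i′) (sym (sameRay-zeroʳ ray Fin.zero (vecA-zero i Fin.zero z≤n))))
  gen-ray-injective (inj₂ i) (inj₁ i′) ray =
    ⊥-elim (<⇒≢ (vecB-first-pos i) (sym (sameRay-zeroˡ ray Fin.zero (vecA-zero i′ Fin.zero z≤n))))
  gen-ray-injective (inj₂ i) (inj₂ i′) ray =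
    cong inj₂ (vecA-ray-injective (sameRay-resp (reverse-vecB≗vecA i) (reverse-vecB≗vecA i′) (sameRay-reverse ray)))
    where
    reverse-vecB≗vecA : ∀ i → reverse (vecB m i) ≗ vecA m i
    reverse-vecB≗vecA i J = trans (vecB≡reverse-vecA m i (opposite J)) (cong (vecA m i) (Fin.opposite-involutive J))

mainTheorem4 : (m : ℕ) →
    ((k : Fin (suc m) ⊎ Fin (suc m)) → SpansExtremeRay m (gen m k)) ×
    ((v : Vecℚ (suc (suc m))) → SpansExtremeRay m v → ∃ λ k → SameRay v (gen m k)) ×
    ((k k′ : Fin (suc m) ⊎ Fin (suc m)) → SameRay (gen m k) (gen m k′) → k ≡ k′)
mainTheorem4 m = gen-extreme , (λ _ → extreme⇒ray-of-generator) , gen-ray-injective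
  where
  gen-extreme : (k : Fin (suc m) ⊎ Fin (suc m)) → SpansExtremeRay m (gen m k)
  gen-extreme (inj₁ i) = vecA-extreme i
  gen-extreme (inj₂ i) = vecB-extreme i
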